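{- Let $n\ge 2$ and let $u_1\cdots u_n$ be the place-based non-inversion table of a permutation $\pi\in S_n$. Then $u_1\cdots u_n$ is a kernel position of the flat Bernoulli game if and only if there exist indices $1=i_0<i_1<\cdots<i_{k+1}=n$ (for some $k\ge0$) such that for each $j\in\{0,\ldots,k\}$ we have $\pi(i_{j+1})<\pi(i_j+1)<\pi(l)$ for all $l$ with $i_j+1<l<i_{j+1}$.
   Context: The place-based non-inversion table of $\pi\in S_n$ is the word $u_1\cdots u_n$ with $u_j=1+|\{i<j:\pi(i)<\pi(j)\}|$; these are exactly the words with $1\le u_j\le j$. The flat Bernoulli game: positions are words $u_1\cdots u_n$ ($n\ge0$) with $1\le u_i\le i$; a valid move replaces $u_1\cdots u_n$ by $u_1\cdots u_m$ for some $1\le m<n$ such that $u_{m+1}<u_j$ for all $j>m+1$. Players alternate; a player unable to move loses; kernel positions are positions of Grundy number zero (every valid move from them leads to a non-kernel position). -}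

module Defs where

open import Data.Nat using (ℕ; zero; suc; _+_; _∸_; _≤_; _<_)
open import Data.Nat.Properties using (_<?_)
open import Data.Fin using (Fin; toℕ; fromℕ<)
open import Data.Fin.Permutation using (Permutation′; _⟨$⟩ʳ_)
open import Data.List using (List; length; filter; applyUpTo)
open import Data.Product using (∃-syntax; _×_)
open import Relation.Nullary using (yes; no; ¬_)

-- A word u₁ ⋯ uₙ is represented by a function u : ℕ → ℕ (1-indexed; only
-- the values u 1, …, u n matter) together with its length n.
-- The prefix u₁ ⋯ uₘ is then represented by (u , m).

ValidMove : (ℕ → ℕ) → ℕ → ℕ → Set
ValidMove u n m = (1 ≤ m) × (m < n) × (∀ j → suc m < j → j ≤ n → u (suc m) < u j)

-- Kernel (Grundy number zero) / non-kernel positions, defined inductively: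
-- a position is kernel iff every valid move leads to a non-kernel position,
-- and non-kernel iff some valid move leads to a kernel position.
-- (The game is finite since moves strictly shorten the word.)
mutual
  data Kernel (u : ℕ → ℕ) (n : ℕ) : Set where
    kernel : (∀ m → ValidMove u n m → NonKernel u m) → Kernel u n

  data NonKernel (u : ℕ → ℕ) (n : ℕ) : Set where
    nonKernel : ∀ m → ValidMove u n m → Kernel u m → NonKernel u n

-- 1-indexed values of a permutation π ∈ Sₙ: perm π i = π(i) ∈ {1,…,n}
-- for 1 ≤ i ≤ n (and 0 outside this range, never used).
perm : ∀ {n} → Permutation′ n → ℕ → ℕ
perm π zero = 0
perm {n} π (suc i) with i <? n
... | yes p = suc (toℕ (π ⟨$⟩ʳ fromℕ< p))
... | no _ = 0

nonInvTable : ∀ {n} → Permutation′ n → ℕ → ℕ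
nonInvTable π j =
  suc (length (filter (λ i → perm π i <? perm π j) (applyUpTo suc (j ∸ 1))))

module Submission where

-- We work with an arbitrary sequence ρ : ℕ → ℕ taking distinct values at
-- positions 1 … n; its non-inversion table is u = table ρ, and the theorem is
-- the case ρ = π.  The argument has three layers.
--  1. Counting: u_j = 1 + #{i < j : ρ i < ρ j}.  From this, a left-to-right
--     comparison of ρ transfers to u (table-<, table-≤), and conversely the
--     move condition "u_{m+1} < u_j for m+1 < j ≤ b" holds iff
--     "ρ_{m+1} < ρ_j for m+1 < j ≤ b" (minFrom-table, minFrom-untable).
--  2. Game: call a < b a link when b is the next position after a+1 whose
--     ρ-value is smaller than ρ_{a+1}.  Kernel positions are exactly the b
--     reachable from 1 by a chain of links: links preserve the kernel
--     property (kernel-step), and the last nontrivial move out of a kernel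
--     position ends in a kernel position linked to it (kernel⇒path).
--  3. Encoding: chains of links are the index sequences 1 = i₀ < ⋯ < i_{k+1}
--     of the statement (path⇒indexChain, indexChain⇒path).

open import Defs
open import Data.Nat using (ℕ; zero; suc; _+_; _∸_; _≤_; _<_; z≤n; s≤s; s≤s⁻¹)
open import Data.Nat.Properties
open import Data.Fin using (Fin; zero; suc; fromℕ; inject₁; toℕ; fromℕ<)
open import Data.Fin.Properties using (toℕ-fromℕ<; toℕ-injective)
open import Data.Fin.Permutation using (Permutation′; _⟨$⟩ˡ_; inverseˡ)
open import Data.Product using (Σ; _×_; _,_; proj₁)
open import Data.Sum using (_⊎_; inj₁; inj₂)
open import Data.Empty using (⊥; ⊥-elim)
open import Data.List using ([]; _∷_; _++_; length; filter; applyUpTo)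
open import Data.List.Properties using (applyUpTo-∷ʳ; filter-++; length-++; filter-accept; filter-reject)
open import Data.List.Relation.Binary.Sublist.Propositional using (⊆-refl)
open import Data.List.Relation.Binary.Sublist.Propositional.Properties using (filter⁺; length-mono-≤)
open import Relation.Binary.Construct.Closure.Transitive using (TransClosure; [_]; _∷_; _∷ʳ_)
open import Relation.Binary.Definitions using (tri<; tri≈; tri>)
open import Relation.Binary.PropositionalEquality
open import Relation.Nullary using (¬_; yes; no)
open import Function.Bundles using (_⇔_; mk⇔)

-- Number of positions 1 ≤ i ≤ k with ρ i < x; the non-inversion table of
-- ρ is u_j = 1 + count ρ (j - 1) (ρ j), literally as in Defs.nonInvTable.
count : (ℕ → ℕ) → ℕ → ℕ → ℕ
count ρ k x = length (filter (λ i → ρ i <? x) (applyUpTo suc k))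

table : (ℕ → ℕ) → ℕ → ℕ
table ρ j = suc (count ρ (j ∸ 1) (ρ j))

-- f p is strictly smaller than every f j with p < j ≤ b.  For f = table ρ
-- and p = m + 1 this is the move condition of ValidMove.
MinFrom : (ℕ → ℕ) → ℕ → ℕ → Set
MinFrom f p b = ∀ j → p < j → j ≤ b → f p < f j

NextSmaller : (ℕ → ℕ) → ℕ → ℕ → Set
NextSmaller f p b = (f b < f p) × (∀ l → p < l → l < b → f p < f l)

Distinct : ℕ → (ℕ → ℕ) → Set
Distinct n ρ = ∀ {i j} → i < n → j < n → ρ (suc i) ≡ ρ (suc j) → i ≡ j

minFrom-restrict : ∀ {f p b b′} → b′ ≤ b → MinFrom f p b → MinFrom f p b′
minFrom-restrict b′≤b h j p<j j≤b′ = h j p<j (≤-trans j≤b′ b′≤b)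

minFrom-extend : ∀ {f p b} → MinFrom f p b → (p < suc b → f p < f (suc b)) → MinFrom f p (suc b)
minFrom-extend h new j p<j j≤1+b with m≤n⇒m<n∨m≡n j≤1+b
... | inj₁ j<1+b = h j p<j (s≤s⁻¹ j<1+b)
... | inj₂ refl  = new p<j

nextSmaller : ∀ {f p b} → MinFrom f p b → f (suc b) < f p → NextSmaller f p (suc b)
nextSmaller h drop = drop , λ l p<l l<1+b → h l p<l (s≤s⁻¹ l<1+b)

nextSmaller-after : ∀ {f p b} → p ≤ b → NextSmaller f p b → p < b
nextSmaller-after p≤b (drop , _) with m≤n⇒m<n∨m≡n p≤b
... | inj₁ p<b = p<b
... | inj₂ refl = ⊥-elim (<-irrefl refl drop)

module NonInversionTable (ρ : ℕ → ℕ) where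

  distinct-order : ∀ {n m b} → Distinct n ρ → m < b → b < n →
    ρ (suc m) < ρ (suc b) ⊎ ρ (suc b) < ρ (suc m)
  distinct-order {m = m} {b} distinct m<b b<n with <-cmp (ρ (suc m)) (ρ (suc b))
  ... | tri< lt _ _ = inj₁ lt
  ... | tri≈ _ eq _ = ⊥-elim (<⇒≢ m<b (distinct (<-trans m<b b<n) b<n eq))
  ... | tri> _ _ gt = inj₂ gt

  count-suc : ∀ k x → count ρ (suc k) x ≡ count ρ k x + length (filter (λ i → ρ i <? x) (suc k ∷ []))
  count-suc k x = begin
    length (filter P? (applyUpTo suc (suc k)))
      ≡⟨ cong (λ xs → length (filter P? xs)) (sym (applyUpTo-∷ʳ suc k)) ⟩
    length (filter P? (applyUpTo suc k ++ suc k ∷ []))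
      ≡⟨ cong length (filter-++ P? (applyUpTo suc k) _) ⟩
    length (filter P? (applyUpTo suc k) ++ filter P? (suc k ∷ []))
      ≡⟨ length-++ (filter P? (applyUpTo suc k)) ⟩
    count ρ k x + length (filter P? (suc k ∷ [])) ∎
    where
    open ≡-Reasoning
    P? = λ i → ρ i <? x

  count-accept : ∀ {k x} → ρ (suc k) < x → count ρ (suc k) x ≡ suc (count ρ k x)
  count-accept {k} {x} lt = begin
    count ρ (suc k) x               ≡⟨ count-suc k x ⟩
    count ρ k x + length (filter (λ i → ρ i <? x) (suc k ∷ []))
                                    ≡⟨ cong (λ xs → count ρ k x + length xs) (filter-accept (λ i → ρ i <? x) lt) ⟩
    count ρ k x + 1                 ≡⟨ +-comm (count ρ k x) 1 ⟩
    suc (count ρ k x)               ∎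
    where open ≡-Reasoning

  count-reject : ∀ {k x} → ¬ ρ (suc k) < x → count ρ (suc k) x ≡ count ρ k x
  count-reject {k} {x} nlt = begin
    count ρ (suc k) x               ≡⟨ count-suc k x ⟩
    count ρ k x + length (filter (λ i → ρ i <? x) (suc k ∷ []))
                                    ≡⟨ cong (λ xs → count ρ k x + length xs) (filter-reject (λ i → ρ i <? x) nlt) ⟩
    count ρ k x + 0                 ≡⟨ +-identityʳ _ ⟩
    count ρ k x                     ∎
    where open ≡-Reasoning

  count-mono-value : ∀ {x y} k → x ≤ y → count ρ k x ≤ count ρ k y
  count-mono-value {x} {y} k x≤y = length-mono-≤
    (filter⁺ (λ i → ρ i <? x) (λ i → ρ i <? y) (λ { refl lt → <-≤-trans lt x≤y }) (⊆-refl {x = applyUpTo suc k}))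

  count-mono-length : ∀ {k x} k′ → k ≤ k′ → count ρ k x ≤ count ρ k′ x
  count-mono-length zero z≤n = ≤-refl
  count-mono-length {k} {x} (suc k′) k≤1+k′ with m≤n⇒m<n∨m≡n k≤1+k′
  ... | inj₂ refl = ≤-refl
  ... | inj₁ k<1+k′ = begin
    count ρ k x                     ≤⟨ count-mono-length k′ (s≤s⁻¹ k<1+k′) ⟩
    count ρ k′ x                    ≤⟨ m≤m+n _ _ ⟩
    count ρ k′ x + _                ≡⟨ sym (count-suc k′ x) ⟩
    count ρ (suc k′) x              ∎
    where open ≤-Reasoning

  count-flat : ∀ {k x} k′ → k ≤ k′ → (∀ l → k < l → l ≤ k′ → ¬ ρ l < x) →
    count ρ k′ x ≡ count ρ k x
  count-flat zero z≤n _ = refl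
  count-flat (suc k′) k≤1+k′ none with m≤n⇒m<n∨m≡n k≤1+k′
  ... | inj₂ refl = refl
  ... | inj₁ k<1+k′ = trans (count-reject (none (suc k′) k<1+k′ ≤-refl))
    (count-flat k′ (s≤s⁻¹ k<1+k′) (λ l k<l l≤k′ → none l k<l (m≤n⇒m≤1+n l≤k′)))

  table-< : ∀ {m J} → m < J → ρ (suc m) < ρ (suc J) → table ρ (suc m) < table ρ (suc J)
  table-< {m} {J} m<J lt = s≤s (begin-strict
    count ρ m (ρ (suc m))           ≤⟨ count-mono-value m (<⇒≤ lt) ⟩
    count ρ m (ρ (suc J))           <⟨ n<1+n _ ⟩
    suc (count ρ m (ρ (suc J)))     ≡⟨ sym (count-accept lt) ⟩
    count ρ (suc m) (ρ (suc J))     ≤⟨ count-mono-length J m<J ⟩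
    count ρ J (ρ (suc J))           ∎)
    where open ≤-Reasoning

  -- If J + 1 is the next smaller element after m + 1, its table entry is
  -- not larger: everything in between exceeds ρ (m + 1) > ρ (J + 1).
  table-≤ : ∀ {m J} → m < J → NextSmaller ρ (suc m) (suc J) → table ρ (suc J) ≤ table ρ (suc m)
  table-≤ {m} {J} m<J (drop , between) = s≤s (begin
    count ρ J (ρ (suc J))           ≡⟨ count-flat J (<⇒≤ m<J) notBelow ⟩
    count ρ m (ρ (suc J))           ≤⟨ count-mono-value m (<⇒≤ drop) ⟩
    count ρ m (ρ (suc m))           ∎)
    where
    open ≤-Reasoning
    notBelow : ∀ l → m < l → l ≤ J → ¬ ρ l < ρ (suc J)
    notBelow l m<l l≤J with m≤n⇒m<n∨m≡n m<l
    ... | inj₂ refl = <-asym drop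
    ... | inj₁ 1+m<l = <-asym (<-trans drop (between l 1+m<l (s≤s l≤J)))

  minFrom-table : ∀ {m b} → MinFrom ρ (suc m) b → MinFrom (table ρ) (suc m) b
  minFrom-table h (suc J) 1+m<1+J J+1≤b = table-< (s≤s⁻¹ 1+m<1+J) (h (suc J) 1+m<1+J J+1≤b)

  -- Conversely, the move condition on the table forces the ρ-minimum,
  -- by induction on b: the first violation would be a next smaller element.
  minFrom-untable : ∀ {n m} → Distinct n ρ → ∀ b → b ≤ n →
    MinFrom (table ρ) (suc m) b → MinFrom ρ (suc m) b
  minFrom-untable distinct zero _ _ j 1+m<j j≤0 = ⊥-elim (<⇒≱ 1+m<j (≤-trans j≤0 z≤n))
  minFrom-untable {n} {m} distinct (suc b) 1+b≤n h = minFrom-extend before last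
    where
    before : MinFrom ρ (suc m) b
    before = minFrom-untable distinct b (≤-trans (n≤1+n b) 1+b≤n) (minFrom-restrict (n≤1+n b) h)
    last : suc m < suc b → ρ (suc m) < ρ (suc b)
    last 1+m<1+b with distinct-order distinct (s≤s⁻¹ 1+m<1+b) 1+b≤n
    ... | inj₁ lt = lt
    ... | inj₂ gt = ⊥-elim (<⇒≱ (h (suc b) 1+m<1+b ≤-refl) (table-≤ (s≤s⁻¹ 1+m<1+b) (nextSmaller before gt)))

Link : (ℕ → ℕ) → ℕ → ℕ → Set
Link ρ a b = (a < b) × NextSmaller ρ (suc a) b

path-increasing : ∀ {ρ a b} → TransClosure (Link ρ) a b → a < b
path-increasing [ a<b , _ ] = a<b
path-increasing ((a<c , _) ∷ p) = <-trans a<c (path-increasing p)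

kernel-exclusive : ∀ {u m} → Kernel u m → NonKernel u m → ⊥
kernel-exclusive (kernel moves) (nonKernel m′ move k′) = kernel-exclusive k′ (moves m′ move)

kernel-one : ∀ {u} → Kernel u 1
kernel-one = kernel λ { m (1≤m , m<1 , _) → ⊥-elim (<⇒≱ m<1 1≤m) }

module Game (ρ : ℕ → ℕ) (n : ℕ) (distinct : Distinct n ρ) where
  open NonInversionTable ρ

  u : ℕ → ℕ
  u = table ρ

  -- Links preserve the kernel property: a move from b either stays below a
  -- (answered as from a), lands on a (forbidden, since ρ drops at b), or
  -- lands strictly between a and b (from where a is reachable).
  kernel-step : ∀ {a b} → 1 ≤ a → Kernel u a → Link ρ a b → b ≤ n → Kernel u b
  kernel-step {a} {b} 1≤a (kernel movesFromA) (a<b , drop , between) b≤n = kernel movesFromB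
    where
    movesFromB : ∀ m → ValidMove u b m → NonKernel u m
    movesFromB m (1≤m , m<b , min) with <-cmp m a
    ... | tri< m<a _ _ = movesFromA m (1≤m , m<a , minFrom-restrict (<⇒≤ a<b) min)
    ... | tri≈ _ refl _ = ⊥-elim (<-asym drop
          (minFrom-untable distinct b b≤n min b (nextSmaller-after a<b (drop , between)) ≤-refl))
    ... | tri> _ _ a<m = nonKernel a (1≤a , a<m ,
          minFrom-table (λ j 1+a<j j≤m → between j 1+a<j (≤-<-trans j≤m m<b))) (kernel movesFromA)

  kernel-along : ∀ {a b} → 1 ≤ a → Kernel u a → TransClosure (Link ρ) a b → b ≤ n → Kernel u b
  kernel-along 1≤a ka [ link ] b≤n = kernel-step 1≤a ka link b≤n
  kernel-along 1≤a ka (link ∷ p) b≤n =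
    kernel-along (≤-trans 1≤a (<⇒≤ (proj₁ link)))
      (kernel-step 1≤a ka link (≤-trans (<⇒≤ (path-increasing p)) b≤n)) p b≤n

  -- From a kernel position L ≥ 2 the move to L - 1 must reach a non-kernel
  -- position, hence L - 1 moves to some kernel m; the move L → m being
  -- forbidden, L is the next smaller element after m + 1.
  mutual
    kernel⇒path : ∀ {L} → 2 ≤ L → L ≤ n → Kernel u L → TransClosure (Link ρ) 1 L
    kernel⇒path {suc zero} (s≤s ()) _ _
    kernel⇒path {suc (suc L)} _ L+2≤n (kernel moves)
      with moves (suc L) (s≤s z≤n , ≤-refl , λ j L+2<j j≤L+2 → ⊥-elim (<⇒≱ L+2<j j≤L+2))
    ... | nonKernel m (1≤m , m<L+1 , min) km = extend m 1≤m m≤n km (m<L+2 , nextSmaller minρ drop)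
      where
      m≤n : m ≤ n
      m≤n = ≤-trans (<⇒≤ m<L+1) (≤-trans (n≤1+n _) L+2≤n)
      m<L+2 : m < suc (suc L)
      m<L+2 = ≤-trans m<L+1 (n≤1+n _)
      minρ : MinFrom ρ (suc m) (suc L)
      minρ = minFrom-untable distinct (suc L) (≤-trans (n≤1+n _) L+2≤n) min
      drop : ρ (suc (suc L)) < ρ (suc m)
      drop with distinct-order distinct m<L+1 L+2≤n
      ... | inj₂ gt = gt
      ... | inj₁ lt = ⊥-elim (kernel-exclusive km
            (moves m (1≤m , m<L+2 , minFrom-extend min (λ _ → table-< m<L+1 lt))))

    extend : ∀ {L} m → 1 ≤ m → m ≤ n → Kernel u m → Link ρ m L → TransClosure (Link ρ) 1 L
    extend (suc zero) _ _ _ link = [ link ]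
    extend (suc (suc m)) _ m≤n km link = kernel⇒path (s≤s (s≤s z≤n)) m≤n km ∷ʳ link

IndexChain : (ℕ → ℕ) → ℕ → ℕ → Set
IndexChain ρ a b = Σ ℕ λ k → Σ (Fin (suc (suc k)) → ℕ) λ i → (
  (i zero ≡ a) × (i (fromℕ (suc k)) ≡ b) ×
  (∀ (j : Fin (suc k)) → i (inject₁ j) < i (suc j)) ×
  (∀ (j : Fin (suc k)) → NextSmaller ρ (i (inject₁ j) + 1) (i (suc j))))

-- Chains of links correspond to index chains; the statement writes the
-- position after i_j as i_j + 1 rather than suc i_j, hence shift/unshift.
module Encoding (ρ : ℕ → ℕ) where

  shift : ∀ {a b} → NextSmaller ρ (a + 1) b → NextSmaller ρ (suc a) b
  shift {a} {b} = subst (λ p → NextSmaller ρ p b) (+-comm a 1)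

  unshift : ∀ {a b} → NextSmaller ρ (suc a) b → NextSmaller ρ (a + 1) b
  unshift {a} {b} = subst (λ p → NextSmaller ρ p b) (+-comm 1 a)

  path⇒indexChain : ∀ {a b} → TransClosure (Link ρ) a b → IndexChain ρ a b
  path⇒indexChain {a} {b} [ a<b , ns ] =
    0 , (λ { zero → a ; (suc _) → b }) , refl , refl , (λ { zero → a<b }) , (λ { zero → unshift ns })
  path⇒indexChain {a} ((a<c , ns) ∷ p) with path⇒indexChain p
  ... | k , i , refl , i-last , i-< , i-ns =
    suc k , (λ { zero → a ; (suc t) → i t }) , refl , i-last ,
    (λ { zero → a<c ; (suc j) → i-< j }) , (λ { zero → unshift ns ; (suc j) → i-ns j })

  indexChain⇒path : ∀ {a b} → IndexChain ρ a b → TransClosure (Link ρ) a b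
  indexChain⇒path (k , i , refl , refl , i-< , i-ns) = fromIndices k i i-< i-ns
    where
    fromIndices : ∀ k (i : Fin (suc (suc k)) → ℕ) →
      (∀ j → i (inject₁ j) < i (suc j)) → (∀ j → NextSmaller ρ (i (inject₁ j) + 1) (i (suc j))) →
      TransClosure (Link ρ) (i zero) (i (fromℕ (suc k)))
    fromIndices zero i i-< i-ns = [ i-< zero , shift (i-ns zero) ]
    fromIndices (suc k) i i-< i-ns =
      (i-< zero , shift (i-ns zero)) ∷ fromIndices k (λ t → i (suc t)) (λ j → i-< (suc j)) (λ j → i-ns (suc j))

perm-distinct : ∀ {n} (π : Permutation′ n) → Distinct n (perm π)
perm-distinct {n} π {i} {j} i<n j<n eq with i <? n | j <? n
... | yes p | yes q = begin
      i                        ≡⟨ sym (toℕ-fromℕ< p) ⟩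
      toℕ (fromℕ< p)           ≡⟨ cong toℕ positions ⟩
      toℕ (fromℕ< q)           ≡⟨ toℕ-fromℕ< q ⟩
      j                        ∎
  where
  open ≡-Reasoning
  positions : fromℕ< p ≡ fromℕ< q
  positions = trans (sym (inverseˡ π))
    (trans (cong (π ⟨$⟩ˡ_) (toℕ-injective (suc-injective eq))) (inverseˡ π))
... | no ¬p | _ = ⊥-elim (¬p i<n)
... | yes _ | no ¬q = ⊥-elim (¬q j<n)

corollary6p6 : (n : ℕ) → 2 ≤ n → (π : Permutation′ n) →
    Kernel (nonInvTable π) n ⇔
      (Σ ℕ λ k → Σ (Fin (suc (suc k)) → ℕ) λ i → (
        (i zero ≡ 1) × (i (fromℕ (suc k)) ≡ n) ×
        (∀ (j : Fin (suc k)) → i (inject₁ j) < i (suc j)) ×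
        (∀ (j : Fin (suc k)) →
          (perm π (i (suc j)) < perm π (i (inject₁ j) + 1)) ×
          (∀ l → i (inject₁ j) + 1 < l → l < i (suc j) →
            perm π (i (inject₁ j) + 1) < perm π l))))
corollary6p6 n 2≤n π = mk⇔
  (λ k → path⇒indexChain (kernel⇒path 2≤n ≤-refl k))
  (λ c → kernel-along (s≤s z≤n) kernel-one (indexChain⇒path c) ≤-refl)
  where
  open Game (perm π) n (perm-distinct π)
  open Encoding (perm π)
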